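{- In the setting below, for $i\in\{1,2\}$ let $X_v^i$ be the indicator that $v\in M_i$. Then for every $v\in V$, $$\tfrac1c\,\mathbb{E}[X_v^1]\le\mathbb{E}[X_v^2]\le c\,\mathbb{E}[X_v^1],$$ and for every $u\prec v$ (with $\Pr[u\in M_3]>0$), $$\tfrac1c\,\mathbb{E}[X_v^1\mid u\in M_3]\le\mathbb{E}[X_v^2\mid u\in M_3]\le c\,\mathbb{E}[X_v^1\mid u\in M_3].$$
   Context: $G=(V,E)$ is a finite graph with a total order $\prec$ on $V$ witnessing inductive independence number $\rho\ge 1$ (for every independent $S$ and every $v$, $|\{u\in S:u\succ v,\{u,v\}\in E\}|\le\rho$). Random subsets $V^I,V^S\subseteq V$ are chosen such that for each $v$ the pair of events $(v\in V^I,v\in V^S)$ is independent of those for other nodes (possibly correlated with each other), and $\frac1c\Pr[v\in V^S]\le\Pr[v\in V^I]\le c\Pr[v\in V^S]$ with a constant $c\ge1$. Sets are built as follows: $M_1$: go through $V^S$ in order $\prec$, adding $v$ if $M_1\cup\{v\}$ is independent. Then process the nodes of $V^I$ in some (adversarial) arrival order: $v$ is added to $M_2$ if there is no $u\in M_1$ with $u\prec v$ and $\{u,v\}\in E$; each $v\in M_2$ is added to $M_3$ independently with probability $q=\frac1{2\rho c}$.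
   Formalization: The constant $c$ is rational, and for each node the joint probabilities of the events $v\in V^I$ and $v\in V^S$ are rational. -}

module Defs where

open import Data.Bool using (Bool; true; false; _∧_; not; if_then_else_)
open import Data.Nat as ℕ using (ℕ; zero; suc)
open import Data.Fin using (Fin; toℕ; _≟_)
open import Data.List using (List; []; _∷_; map; foldr; foldl; concatMap; allFin; filterᵇ; length)
open import Data.Bool.ListAction using (all; any)
open import Data.Product using (_×_; _,_; proj₁; proj₂)
open import Data.Integer as ℤ using (+_)
open import Data.Rational using (ℚ; 0ℚ; 1ℚ; _+_; _*_; _-_; _÷_; _≤_; _<_; _/_; NonZero; 1/_; >-nonZero; *<*)
open import Data.Rational.Properties using (<-≤-trans)
import Data.Nat.Properties as ℕₚ
open import Data.Vec.Functional as VF using ()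
open import Relation.Binary.PropositionalEquality using (_≡_)
open import Relation.Nullary.Decidable using (⌊_⌋)

-- Graphs on the vertex set Fin n.  The total order ≺ on V is the
-- natural order of Fin n (u ≺ v  iff  toℕ u < toℕ v).

Graph : ℕ → Set
Graph n = Fin n → Fin n → Bool

IsSimple : ∀ {n} → Graph n → Set
IsSimple {n} E = (∀ u v → E u v ≡ E v u) × (∀ v → E v v ≡ false)

_≺ᵇ_ : ∀ {n} → Fin n → Fin n → Bool
u ≺ᵇ v = toℕ u ℕ.<ᵇ toℕ v

_≺_ : ∀ {n} → Fin n → Fin n → Set
u ≺ v = toℕ u ℕ.< toℕ v

VSet : ℕ → Set
VSet n = Fin n → Bool

Independent : ∀ {n} → Graph n → VSet n → Set
Independent E S = ∀ u w → S u ≡ true → S w ≡ true → E u w ≡ false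

InductiveIndependence : ∀ {n} → Graph n → ℕ → Set
InductiveIndependence {n} E ρ =
  (S : VSet n) → Independent E S → (v : Fin n) →
  length (filterᵇ (λ u → S u ∧ (v ≺ᵇ u) ∧ E u v) (allFin n)) ℕ.≤ ρ

-- Probability space.
-- Per-node outcome: (v ∈ V^I , v ∈ V^S , coin of v used for M₃).
Ω₁ : Set
Ω₁ = Bool × Bool × Bool

allΩ₁ : List Ω₁
allΩ₁ = concatMap (λ i → concatMap (λ s → map (λ k → i , s , k) (true ∷ false ∷ [])) (true ∷ false ∷ [])) (true ∷ false ∷ [])

Outcome : ℕ → Set
Outcome n = Fin n → Ω₁

allOutcomes : (n : ℕ) → List (Outcome n)
allOutcomes zero = (λ ()) ∷ []
allOutcomes (suc n) = concatMap (λ x → map (λ f → x VF.∷ f) (allOutcomes n)) allΩ₁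

inVI inVS coin : ∀ {n} → Outcome n → Fin n → Bool
inVI ω v = proj₁ (ω v)
inVS ω v = proj₁ (proj₂ (ω v))
coin ω v = proj₂ (proj₂ (ω v))

-- joint law of (v ∈ V^I , v ∈ V^S) for each node v, independent across nodes
JointLaw : ℕ → Set
JointLaw n = Fin n → Bool → Bool → ℚ

IsJointLaw : ∀ {n} → JointLaw n → Set
IsJointLaw {n} p = (∀ v i s → 0ℚ ≤ p v i s) ×
  (∀ v → p v true true + p v true false + p v false true + p v false false ≡ 1ℚ)

PrVI PrVS : ∀ {n} → JointLaw n → Fin n → ℚ
PrVI p v = p v true true + p v true false
PrVS p v = p v true true + p v false true

sumL : ∀ {A : Set} → (A → ℚ) → List A → ℚ
sumL f xs = foldr (λ x r → f x + r) 0ℚ xs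

prodFin : ∀ {n} → (Fin n → ℚ) → ℚ
prodFin {n} f = foldr (λ v r → f v * r) 1ℚ (allFin n)

weight : ∀ {n} → JointLaw n → ℚ → Outcome n → ℚ
weight p q ω = prodFin (λ v → p v (inVI ω v) (inVS ω v) *
                              (if coin ω v then q else (1ℚ - q)))

𝟙 : Bool → ℚ
𝟙 true = 1ℚ
𝟙 false = 0ℚ

E[_] : ∀ {n} → (Outcome n → Bool) → JointLaw n → ℚ → ℚ
E[ X ] p q = sumL (λ ω → weight p q ω * 𝟙 (X ω)) (allOutcomes _)

E[_∣_] : ∀ {n} → (X A : Outcome n → Bool) → (p : JointLaw n) → (q : ℚ) →
         0ℚ < E[ A ] p q → ℚ
E[ X ∣ A ] p q pos = (E[ (λ ω → X ω ∧ A ω) ] p q ÷ E[ A ] p q) {{>-nonZero pos}}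

inv : (c : ℚ) → 1ℚ ≤ c → ℚ
inv c h = (1/ c) {{>-nonZero (<-≤-trans (*<* (ℤ.+<+ (ℕ.s≤s ℕ.z≤n))) h)}}

qVal : (ρ : ℕ) → 1 ℕ.≤ ρ → (c : ℚ) → 1ℚ ≤ c → ℚ
qVal ρ hρ c hc = ((+ 1 / (2 ℕ.* ρ)) {{ℕ.>-nonZero (ℕₚ.≤-trans hρ (ℕₚ.m≤n*m ρ 2))}}) * inv c hc

module Sets {n : ℕ} (E : Graph n) (ω : Outcome n) where

  independentL : List (Fin n) → Bool
  independentL xs = all (λ u → all (λ w → not (E u w)) xs) xs

  step : List (Fin n) → Fin n → List (Fin n)
  step acc v = if inVS ω v ∧ independentL (v ∷ acc) then v ∷ acc else acc

  M₁ : List (Fin n)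
  M₁ = foldl step [] (allFin n)

  inM₁ : Fin n → Bool
  inM₁ v = any (λ u → ⌊ u ≟ v ⌋) M₁

  -- M₂: v ∈ V^I with no u ∈ M₁, u ≺ v, {u,v} ∈ E
  -- (independent of the arrival order of V^I)
  inM₂ : Fin n → Bool
  inM₂ v = inVI ω v ∧ not (any (λ u → (u ≺ᵇ v) ∧ E u v) M₁)

  inM₃ : Fin n → Bool
  inM₃ v = inM₂ v ∧ coin ω v

X¹ X² M₃ : ∀ {n} → Graph n → Fin n → Outcome n → Bool
X¹ E v ω = Sets.inM₁ E ω v
X² E v ω = Sets.inM₂ E ω v
M₃ E u ω = Sets.inM₃ E ω u

module Submission where

-- Fix a node v and split the nodes into those before v and
-- those after it.  The greedy construction of M₁ treats the nodes before v
-- first; call v "unblocked" if none of the greedily chosen earlier nodes is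
-- a neighbour of v.  Then
--     v ∈ M₁  ⇔  v ∈ V^S ∧ unblocked v,      v ∈ M₂  ⇔  v ∈ V^I ∧ unblocked v,
-- and "unblocked v" only depends on the randomness of nodes before v.  In
-- the product measure an event that ignores node v is independent of the
-- outcome at v, so for any such event A
--     Pr[X¹_v ∧ A] = Pr[v ∈ V^S]·Pr[unblocked v ∧ A],
--     Pr[X²_v ∧ A] = Pr[v ∈ V^I]·Pr[unblocked v ∧ A],
-- and the bounds 1/c·Pr[V^S] ≤ Pr[V^I] ≤ c·Pr[V^S] transfer.  Taking A
-- trivial gives the unconditional claim; taking A = "u ∈ M₃" with u ≺ v
-- (an event about nodes ≤ u only) and dividing by Pr[A] gives the
-- conditional one.

open import Defs
open import Data.Nat as ℕ using (ℕ)
open import Data.Fin using (Fin)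
open import Data.Product using (_×_)
open import Data.Rational using (ℚ; 0ℚ; 1ℚ; _*_; _≤_; _<_)
open import Relation.Binary.PropositionalEquality using (_≡_)

open import Data.Bool using (Bool; true; false; _∧_; _∨_; not; if_then_else_)
open import Data.Bool.Properties using (∧-assoc; ∧-idem; ∧-identityʳ; ∧-commutativeMonoid)
open import Data.Bool.ListAction using (all; any)
open import Data.Nat using (zero; suc; z≤n; s≤s)
import Data.Nat.Properties as ℕₚ
open import Data.Fin using (zero; suc; toℕ; _≟_)
open import Data.Fin.Properties using (<⇒≢)
open import Data.List using (List; []; _∷_; map; foldr; foldl; concatMap; _++_; allFin)
open import Data.List.Properties using (foldl-++; foldr-map; map-tabulate; map-++)
open import Data.List.Relation.Unary.All as All using (All; []; _∷_)
open import Data.List.Relation.Unary.All.Properties using (map⁺; tabulate⁺)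
open import Data.Product using (_,_; proj₁; proj₂)
import Data.Vec.Functional as VF
import Data.Integer as ℤ
open import Data.Rational using (_+_; _-_; -_; 1/_; _/_; _÷_; Positive; >-nonZero; positive; nonNegative; *≤*; *<*)
import Data.Rational.Properties as ℚₚ
open import Algebra.Bundles using (CommutativeMonoid)
open import Algebra.Properties.CommutativeSemigroup (CommutativeMonoid.commutativeSemigroup ℚₚ.*-1-commutativeMonoid) using (x∙yz≈y∙xz)
open import Algebra.Properties.CommutativeSemigroup (CommutativeMonoid.commutativeSemigroup ∧-commutativeMonoid) using () renaming (interchange to ∧-interchange)
import Data.Rational.Unnormalised as ℚᵘ
import Data.Rational.Unnormalised.Properties as ℚᵘₚ
open import Data.Rational.Solver using (module +-*-Solver)
open import Relation.Binary.PropositionalEquality using (refl; sym; trans; cong; cong₂; subst; subst₂; module ≡-Reasoning)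
open import Relation.Nullary using (¬_; _because_; contradiction)
open import Relation.Nullary.Decidable using (⌊_⌋; isYes≗does; dec-true; dec-false)

module _ {A : Set} where

  sumL-cong : ∀ {f g : A → ℚ} → (∀ x → f x ≡ g x) → ∀ xs → sumL f xs ≡ sumL g xs
  sumL-cong h []       = refl
  sumL-cong h (x ∷ xs) = cong₂ _+_ (h x) (sumL-cong h xs)

  sumL-++ : ∀ (f : A → ℚ) xs ys → sumL f (xs ++ ys) ≡ sumL f xs + sumL f ys
  sumL-++ f []       ys = sym (ℚₚ.+-identityˡ _)
  sumL-++ f (x ∷ xs) ys = trans (cong (f x +_) (sumL-++ f xs ys)) (sym (ℚₚ.+-assoc (f x) _ _))

  sumL-*ˡ : ∀ (a : ℚ) (f : A → ℚ) xs → sumL (λ x → a * f x) xs ≡ a * sumL f xs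
  sumL-*ˡ a f []       = sym (ℚₚ.*-zeroʳ a)
  sumL-*ˡ a f (x ∷ xs) = trans (cong (a * f x +_) (sumL-*ˡ a f xs)) (sym (ℚₚ.*-distribˡ-+ a (f x) _))

  sumL-*ʳ : ∀ (a : ℚ) (f : A → ℚ) xs → sumL (λ x → f x * a) xs ≡ sumL f xs * a
  sumL-*ʳ a f xs = trans (sumL-cong (λ x → ℚₚ.*-comm (f x) a) xs)
                         (trans (sumL-*ˡ a f xs) (ℚₚ.*-comm a _))

  sumL-nonneg : ∀ (f : A → ℚ) → (∀ x → 0ℚ ≤ f x) → ∀ xs → 0ℚ ≤ sumL f xs
  sumL-nonneg f h []       = ℚₚ.≤-refl
  sumL-nonneg f h (x ∷ xs) = ℚₚ.+-mono-≤ (h x) (sumL-nonneg f h xs)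

sumL-concatMap : ∀ {A B : Set} (f : B → ℚ) (g : A → List B) xs →
  sumL f (concatMap g xs) ≡ sumL (λ x → sumL f (g x)) xs
sumL-concatMap f g []       = refl
sumL-concatMap f g (x ∷ xs) =
  trans (sumL-++ f (g x) (concatMap g xs)) (cong (sumL f (g x) +_) (sumL-concatMap f g xs))

sumL-map : ∀ {A B : Set} (f : B → ℚ) (h : A → B) xs → sumL f (map h xs) ≡ sumL (λ x → f (h x)) xs
sumL-map f h []       = refl
sumL-map f h (x ∷ xs) = cong (f (h x) +_) (sumL-map f h xs)

0≤1 : 0ℚ ≤ 1ℚ
0≤1 = *≤* (ℤ.+≤+ z≤n)

0≤𝟙 : ∀ b → 0ℚ ≤ 𝟙 b
0≤𝟙 true  = 0≤1
0≤𝟙 false = ℚₚ.≤-refl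

nonneg-* : ∀ {a b} → 0ℚ ≤ a → 0ℚ ≤ b → 0ℚ ≤ a * b
nonneg-* {a} {b} ha hb =
  ℚₚ.nonNegative⁻¹ (a * b) {{ℚₚ.nonNeg*nonNeg⇒nonNeg a {{nonNegative ha}} b {{nonNegative hb}}}}

allFin-suc : ∀ n → allFin (suc n) ≡ zero ∷ map suc (allFin n)
allFin-suc n = cong (zero ∷_) (sym (map-tabulate (λ i → i) suc))

prodFin-suc : ∀ {n} (h : Fin (suc n) → ℚ) → prodFin h ≡ h zero * prodFin (λ w → h (suc w))
prodFin-suc {n} h =
  trans (cong (foldr (λ v r → h v * r) 1ℚ) (allFin-suc n)) (cong (h zero *_) (foldr-map _ suc 1ℚ (allFin n)))

prodFin-nonneg : ∀ {n} (h : Fin n → ℚ) → (∀ v → 0ℚ ≤ h v) → 0ℚ ≤ prodFin h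
prodFin-nonneg {zero}  h hh = 0≤1
prodFin-nonneg {suc n} h hh =
  subst (0ℚ ≤_) (sym (prodFin-suc h)) (nonneg-* (hh zero) (prodFin-nonneg (λ w → h (suc w)) (λ w → hh (suc w))))

-- Product measures.  Node v independently takes outcome o ∈ Ω₁ with weight
-- W v o; `Pr W X` is the probability of the event X.  The paper's measure
-- `E[_] p q` is the instance `paperWeights p q` below, definitionally.

Weights : ℕ → Set
Weights n = Fin n → Ω₁ → ℚ

prodWeight : ∀ {n} → Weights n → Outcome n → ℚ
prodWeight W ω = prodFin (λ v → W v (ω v))

Pr : ∀ {n} → Weights n → (Outcome n → Bool) → ℚ
Pr W X = sumL (λ ω → prodWeight W ω * 𝟙 (X ω)) (allOutcomes _)

marginal : ∀ {n} → Weights n → Fin n → (Ω₁ → Bool) → ℚ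
marginal W v g = sumL (λ o → W v o * 𝟙 (g o)) allΩ₁

IgnoresNode : ∀ {n} → Fin n → (Outcome n → Bool) → Set
IgnoresNode {n} v B = ∀ (ω ω' : Outcome n) → (∀ w → ¬ (w ≡ v) → ω w ≡ ω' w) → B ω ≡ B ω'

Pr-cong : ∀ {n} (W : Weights n) {X Y : Outcome n → Bool} → (∀ ω → X ω ≡ Y ω) → Pr W X ≡ Pr W Y
Pr-cong W h = sumL-cong (λ ω → cong (λ b → prodWeight W ω * 𝟙 b) (h ω)) (allOutcomes _)

Pr-nonneg : ∀ {n} (W : Weights n) → (∀ v o → 0ℚ ≤ W v o) → ∀ X → 0ℚ ≤ Pr W X
Pr-nonneg W hW X =
  sumL-nonneg _ (λ ω → nonneg-* (prodFin-nonneg _ (λ v → hW v (ω v))) (0≤𝟙 (X ω))) (allOutcomes _)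

Pr-impossible : ∀ {n} (W : Weights n) → Pr W (λ _ → false) ≡ 0ℚ
Pr-impossible {n} W = trans (sumL-*ʳ 0ℚ (prodWeight W) (allOutcomes n)) (ℚₚ.*-zeroʳ (sumL (prodWeight W) (allOutcomes n)))

tailWeights : ∀ {n} → Weights (suc n) → Weights n
tailWeights W w = W (suc w)

Pr-suc : ∀ {n} (W : Weights (suc n)) (X : Outcome (suc n) → Bool) →
  Pr W X ≡ sumL (λ x → W zero x * Pr (tailWeights W) (λ f → X (x VF.∷ f))) allΩ₁
Pr-suc {n} W X =
  trans (sumL-concatMap F (λ x → map (x VF.∷_) (allOutcomes n)) allΩ₁)
        (sumL-cong (λ x → trans (sumL-map F (x VF.∷_) (allOutcomes n))
                                (trans (sumL-cong (split x) (allOutcomes n))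
                                       (sumL-*ˡ (W zero x) _ (allOutcomes n)))) allΩ₁)
  where
  F : Outcome (suc n) → ℚ
  F ω = prodWeight W ω * 𝟙 (X ω)
  split : ∀ x f → F (x VF.∷ f) ≡ W zero x * (prodWeight (tailWeights W) f * 𝟙 (X (x VF.∷ f)))
  split x f = trans (cong (_* 𝟙 (X (x VF.∷ f))) (prodFin-suc (λ v → W v ((x VF.∷ f) v))))
                    (ℚₚ.*-assoc (W zero x) _ _)

Pr-factor : ∀ {n} (W : Weights n) → (∀ v → marginal W v (λ _ → true) ≡ 1ℚ) →
  (v : Fin n) (g : Ω₁ → Bool) (B : Outcome n → Bool) → IgnoresNode v B →
  Pr W (λ ω → g (ω v) ∧ B ω) ≡ marginal W v g * Pr W B
Pr-factor {suc n} W norm zero g B ignores =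
  trans (head g) (cong (marginal W zero g *_) (sym Pr-B))
  where
  open ≡-Reasoning
  W' : Weights n
  W' = tailWeights W
  x₀ : Ω₁
  x₀ = true , true , true
  e : ℚ
  e = Pr W' (λ f → B (x₀ VF.∷ f))
  -- B cannot see the head, so it may be evaluated with any fixed head
  agree : ∀ x (f : Outcome n) → B (x VF.∷ f) ≡ B (x₀ VF.∷ f)
  agree x f = ignores _ _ λ { zero ne → contradiction refl ne ; (suc w) ne → refl }
  restrict : (h : Ω₁ → Bool) (x : Ω₁) → Pr W' (λ f → h x ∧ B (x VF.∷ f)) ≡ 𝟙 (h x) * e
  restrict h x with h x
  ... | true  = trans (Pr-cong W' (agree x)) (sym (ℚₚ.*-identityˡ e))
  ... | false = trans (Pr-impossible W') (sym (ℚₚ.*-zeroˡ e))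
  head : (h : Ω₁ → Bool) → Pr W (λ ω → h (ω zero) ∧ B ω) ≡ marginal W zero h * e
  head h = begin
      Pr W (λ ω → h (ω zero) ∧ B ω)
    ≡⟨ Pr-suc W (λ ω → h (ω zero) ∧ B ω) ⟩
      sumL (λ x → W zero x * Pr W' (λ f → h x ∧ B (x VF.∷ f))) allΩ₁
    ≡⟨ sumL-cong (λ x → trans (cong (W zero x *_) (restrict h x)) (sym (ℚₚ.*-assoc (W zero x) (𝟙 (h x)) e))) allΩ₁ ⟩
      sumL (λ x → W zero x * 𝟙 (h x) * e) allΩ₁
    ≡⟨ sumL-*ʳ e (λ x → W zero x * 𝟙 (h x)) allΩ₁ ⟩
      marginal W zero h * e
    ∎
  -- B is the event "true at node zero, and B"
  Pr-B : Pr W B ≡ e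
  Pr-B = trans (head (λ _ → true)) (trans (cong (_* e) (norm zero)) (ℚₚ.*-identityˡ e))
Pr-factor {suc n} W norm (suc v) g B ignores = begin
    Pr W (λ ω → g (ω (suc v)) ∧ B ω)
  ≡⟨ Pr-suc W (λ ω → g (ω (suc v)) ∧ B ω) ⟩
    sumL (λ x → W zero x * Pr W' (λ f → g (f v) ∧ B (x VF.∷ f))) allΩ₁
  ≡⟨ sumL-cong (λ x → cong (W zero x *_) (Pr-factor W' (λ w → norm (suc w)) v g (B-at x) (ignores-tail x))) allΩ₁ ⟩
    sumL (λ x → W zero x * (P * Pr W' (B-at x))) allΩ₁
  ≡⟨ sumL-cong (λ x → x∙yz≈y∙xz (W zero x) P (Pr W' (B-at x))) allΩ₁ ⟩
    sumL (λ x → P * (W zero x * Pr W' (B-at x))) allΩ₁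
  ≡⟨ sumL-*ˡ P (λ x → W zero x * Pr W' (B-at x)) allΩ₁ ⟩
    P * sumL (λ x → W zero x * Pr W' (B-at x)) allΩ₁
  ≡⟨ cong (P *_) (sym (Pr-suc W B)) ⟩
    P * Pr W B
  ∎
  where
  open ≡-Reasoning
  W' : Weights n
  W' = tailWeights W
  P : ℚ
  P = marginal W' v g
  B-at : Ω₁ → Outcome n → Bool
  B-at x f = B (x VF.∷ f)
  ignores-tail : ∀ x → IgnoresNode v (B-at x)
  ignores-tail x f f' h = ignores _ _ λ { zero ne → refl ; (suc w) ne → h w (λ eq → ne (cong suc eq)) }

paperWeights : ∀ {n} → JointLaw n → ℚ → Weights n
paperWeights p q v o = p v (proj₁ o) (proj₁ (proj₂ o)) * (if proj₂ (proj₂ o) then q else 1ℚ - q)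

inVI₁ inVS₁ : Ω₁ → Bool
inVI₁ o = proj₁ o
inVS₁ o = proj₁ (proj₂ o)

-- Summing a node's weight over its eight outcomes (the coin sums out):
-- the total, the V^S-marginal and the V^I-marginal, as ring identities.
module CoinSums where
  open +-*-Solver

  total : ∀ a b c d q →
    a * q * 1ℚ + (a * (1ℚ - q) * 1ℚ + (b * q * 1ℚ + (b * (1ℚ - q) * 1ℚ + (c * q * 1ℚ
      + (c * (1ℚ - q) * 1ℚ + (d * q * 1ℚ + (d * (1ℚ - q) * 1ℚ + 0ℚ))))))) ≡ a + b + c + d
  total = solve 5 (λ a b c d q →
    a :* q :* con 1ℚ :+ (a :* (con 1ℚ :- q) :* con 1ℚ :+ (b :* q :* con 1ℚ :+ (b :* (con 1ℚ :- q) :* con 1ℚ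
      :+ (c :* q :* con 1ℚ :+ (c :* (con 1ℚ :- q) :* con 1ℚ :+ (d :* q :* con 1ℚ :+ (d :* (con 1ℚ :- q) :* con 1ℚ
      :+ con 0ℚ))))))) := a :+ b :+ c :+ d) refl

  inS : ∀ a b c d q →
    a * q * 1ℚ + (a * (1ℚ - q) * 1ℚ + (b * q * 0ℚ + (b * (1ℚ - q) * 0ℚ + (c * q * 1ℚ
      + (c * (1ℚ - q) * 1ℚ + (d * q * 0ℚ + (d * (1ℚ - q) * 0ℚ + 0ℚ))))))) ≡ a + c
  inS = solve 5 (λ a b c d q →
    a :* q :* con 1ℚ :+ (a :* (con 1ℚ :- q) :* con 1ℚ :+ (b :* q :* con 0ℚ :+ (b :* (con 1ℚ :- q) :* con 0ℚ
      :+ (c :* q :* con 1ℚ :+ (c :* (con 1ℚ :- q) :* con 1ℚ :+ (d :* q :* con 0ℚ :+ (d :* (con 1ℚ :- q) :* con 0ℚ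
      :+ con 0ℚ))))))) := a :+ c) refl

  inI : ∀ a b c d q →
    a * q * 1ℚ + (a * (1ℚ - q) * 1ℚ + (b * q * 1ℚ + (b * (1ℚ - q) * 1ℚ + (c * q * 0ℚ
      + (c * (1ℚ - q) * 0ℚ + (d * q * 0ℚ + (d * (1ℚ - q) * 0ℚ + 0ℚ))))))) ≡ a + b
  inI = solve 5 (λ a b c d q →
    a :* q :* con 1ℚ :+ (a :* (con 1ℚ :- q) :* con 1ℚ :+ (b :* q :* con 1ℚ :+ (b :* (con 1ℚ :- q) :* con 1ℚ
      :+ (c :* q :* con 0ℚ :+ (c :* (con 1ℚ :- q) :* con 0ℚ :+ (d :* q :* con 0ℚ :+ (d :* (con 1ℚ :- q) :* con 0ℚ
      :+ con 0ℚ))))))) := a :+ b) refl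

module _ {n : ℕ} (p : JointLaw n) (q : ℚ) where

  paperWeights-normalised : IsJointLaw p → ∀ v → marginal (paperWeights p q) v (λ _ → true) ≡ 1ℚ
  paperWeights-normalised (_ , sums) v =
    trans (CoinSums.total (p v true true) (p v true false) (p v false true) (p v false false) q) (sums v)

  marginal-VS : ∀ v → marginal (paperWeights p q) v inVS₁ ≡ PrVS p v
  marginal-VS v = CoinSums.inS (p v true true) (p v true false) (p v false true) (p v false false) q

  marginal-VI : ∀ v → marginal (paperWeights p q) v inVI₁ ≡ PrVI p v
  marginal-VI v = CoinSums.inI (p v true true) (p v true false) (p v false true) (p v false false) q

  paperWeights-nonneg : IsJointLaw p → 0ℚ ≤ q → 0ℚ ≤ 1ℚ - q → ∀ v o → 0ℚ ≤ paperWeights p q v o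
  paperWeights-nonneg (p≥0 , _) q≥0 1-q≥0 v (i , s , true)  = nonneg-* (p≥0 v i s) q≥0
  paperWeights-nonneg (p≥0 , _) q≥0 1-q≥0 v (i , s , false) = nonneg-* (p≥0 v i s) 1-q≥0

≺ᵇ-true : ∀ {n} {u v : Fin n} → u ≺ v → (u ≺ᵇ v) ≡ true
≺ᵇ-true {u = u} {v} = dec-true (_ because ℕₚ.<ᵇ-reflects-< (toℕ u) (toℕ v))

≺ᵇ-false : ∀ {n} {u v : Fin n} → ¬ (u ≺ v) → (u ≺ᵇ v) ≡ false
≺ᵇ-false {u = u} {v} = dec-false (_ because ℕₚ.<ᵇ-reflects-< (toℕ u) (toℕ v))

≟-refl : ∀ {n} (v : Fin n) → ⌊ v ≟ v ⌋ ≡ true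
≟-refl v = trans (isYes≗does (v ≟ v)) (dec-true (v ≟ v) refl)

≟-≢ : ∀ {n} {u v : Fin n} → ¬ (u ≡ v) → ⌊ u ≟ v ⌋ ≡ false
≟-≢ {u = u} {v} u≢v = trans (isYes≗does (u ≟ v)) (dec-false (u ≟ v) u≢v)

record Split {n : ℕ} (v : Fin n) : Set where
  field
    before after : List (Fin n)
    allFin-split : allFin n ≡ before ++ v ∷ after
    before-≺     : All (_≺ v) before
    after-≻      : All (v ≺_) after

split : ∀ {n} (v : Fin n) → Split v
split {suc n} zero = record
  { before = [] ; after = map suc (allFin n) ; allFin-split = allFin-suc n
  ; before-≺ = [] ; after-≻ = map⁺ (tabulate⁺ (λ _ → s≤s z≤n)) }
split {suc n} (suc v) = record
  { before = zero ∷ map suc before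
  ; after  = map suc after
  ; allFin-split = trans (allFin-suc n)
                   (cong (zero ∷_) (trans (cong (map suc) allFin-split) (map-++ suc before (v ∷ after))))
  ; before-≺ = s≤s z≤n ∷ map⁺ (All.map s≤s before-≺)
  ; after-≻  = map⁺ (All.map s≤s after-≻) }
  where open Split (split v)

all-∧ : ∀ {A : Set} (f g : A → Bool) xs → all (λ u → f u ∧ g u) xs ≡ all f xs ∧ all g xs
all-∧ f g []       = refl
all-∧ f g (x ∷ xs) = trans (cong ((f x ∧ g x) ∧_) (all-∧ f g xs)) (∧-interchange (f x) (g x) (all f xs) (all g xs))

all-cong-All : ∀ {A : Set} {P : A → Set} (f g : A → Bool) {xs} → All P xs → (∀ {x} → P x → f x ≡ g x) → all f xs ≡ all g xs
all-cong-All f g []         h = refl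
all-cong-All f g (px ∷ pxs) h = cong₂ _∧_ (h px) (all-cong-All f g pxs h)

all-not : ∀ {A : Set} (f : A → Bool) xs → all (λ u → not (f u)) xs ≡ not (any f xs)
all-not f []       = refl
all-not f (x ∷ xs) with f x
... | true  = refl
... | false = all-not f xs

module Greedy {n : ℕ} (E : Graph n) where

  independent : List (Fin n) → Bool
  independent xs = all (λ u → all (λ w → not (E u w)) xs) xs

  blocks : List (Fin n) → Fin n → Bool
  blocks xs v = any (λ u → (u ≺ᵇ v) ∧ E u v) xs

  greedy : Outcome n → List (Fin n) → List (Fin n) → List (Fin n)
  greedy ω = foldl (Sets.step E ω)

  -- only processed nodes can be added: a test failing on all of them is unaffected
  greedy-any : ∀ ω (P : Fin n → Bool) acc zs → All (λ z → P z ≡ false) zs →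
    any P (greedy ω acc zs) ≡ any P acc
  greedy-any ω P acc []       []         = refl
  greedy-any ω P acc (z ∷ zs) (pz ∷ pzs) = trans (greedy-any ω P _ zs pzs) step
    where
    step : any P (Sets.step E ω acc z) ≡ any P acc
    step with inVS ω z ∧ independent (z ∷ acc)
    ... | true  = cong (_∨ any P acc) pz
    ... | false = refl

  greedy-local : ∀ ω ω' acc zs → All (λ w → inVS ω w ≡ inVS ω' w) zs →
    greedy ω acc zs ≡ greedy ω' acc zs
  greedy-local ω ω' acc []       []       = refl
  greedy-local ω ω' acc (w ∷ zs) (e ∷ es) =
    trans (cong (λ b → greedy ω (if b ∧ independent (w ∷ acc) then w ∷ acc else acc) zs) e)
          (greedy-local ω ω' _ zs es)

  greedy-All : ∀ ω (Q : Fin n → Set) acc zs → All Q acc → All Q zs → All Q (greedy ω acc zs)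
  greedy-All ω Q acc []       qacc []         = qacc
  greedy-All ω Q acc (z ∷ zs) qacc (qz ∷ qzs) = greedy-All ω Q _ zs step qzs
    where
    step : All Q (Sets.step E ω acc z)
    step with inVS ω z ∧ independent (z ∷ acc)
    ... | true  = qz ∷ qacc
    ... | false = qacc

  greedy-independent : ∀ ω acc zs → independent acc ≡ true → independent (greedy ω acc zs) ≡ true
  greedy-independent ω acc []       ind = ind
  greedy-independent ω acc (z ∷ zs) ind = greedy-independent ω _ zs step
    where
    step : independent (Sets.step E ω acc z) ≡ true
    step with inVS ω z | independent (z ∷ acc) in ind′
    ... | true  | true  = ind′
    ... | true  | false = ind
    ... | false | _     = ind

  independent-cons : IsSimple E → ∀ v acc → independent acc ≡ true → All (_≺ v) acc →
    independent (v ∷ acc) ≡ not (blocks acc v)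
  independent-cons (symmetric , loopless) v acc ind earlier = begin
      independent (v ∷ acc)
    ≡⟨ cong (λ b → (not b ∧ row) ∧ all (λ u → not (E u v) ∧ all (λ w → not (E u w)) acc) acc) (loopless v) ⟩
      row ∧ all (λ u → not (E u v) ∧ all (λ w → not (E u w)) acc) acc
    ≡⟨ cong (row ∧_) (all-∧ (λ u → not (E u v)) (λ u → all (λ w → not (E u w)) acc) acc) ⟩
      row ∧ (column ∧ independent acc)
    ≡⟨ cong (λ b → row ∧ (column ∧ b)) ind ⟩
      row ∧ (column ∧ true)
    ≡⟨ cong (row ∧_) (∧-identityʳ column) ⟩
      row ∧ column
    ≡⟨ cong (_∧ column) (all-cong-All (λ w → not (E v w)) (λ w → not (E w v)) earlier
                                      (λ {w} _ → cong not (symmetric v w))) ⟩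
      column ∧ column
    ≡⟨ ∧-idem column ⟩
      column
    ≡⟨ all-cong-All (λ u → not (E u v)) (λ u → not ((u ≺ᵇ v) ∧ E u v)) earlier
                    (λ {u} u≺v → cong (λ b → not (b ∧ E u v)) (sym (≺ᵇ-true u≺v))) ⟩
      all (λ u → not ((u ≺ᵇ v) ∧ E u v)) acc
    ≡⟨ all-not (λ u → (u ≺ᵇ v) ∧ E u v) acc ⟩
      not (blocks acc v)
    ∎
    where
    open ≡-Reasoning
    row column : Bool
    row    = all (λ w → not (E v w)) acc
    column = all (λ u → not (E u v)) acc

  chosenBefore : Fin n → Outcome n → List (Fin n)
  chosenBefore v ω = greedy ω [] (Split.before (split v))

  unblocked : Fin n → Outcome n → Bool
  unblocked v ω = not (blocks (chosenBefore v ω) v)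

  module _ (v : Fin n) (ω : Outcome n) where
    open Split (split v)

    M₁-split : Sets.M₁ E ω ≡ greedy ω (Sets.step E ω (chosenBefore v ω) v) after
    M₁-split = trans (cong (greedy ω []) allFin-split) (foldl-++ (Sets.step E ω) [] before (v ∷ after))

    -- v ∈ M₂ iff v ∈ V^I and v is unblocked (later choices cannot block v)
    X²-unblocked : X² E v ω ≡ inVI ω v ∧ unblocked v ω
    X²-unblocked = cong (λ b → inVI ω v ∧ not b)
      (trans (cong (λ xs → blocks xs v) M₁-split)
             (greedy-any ω (λ u → (u ≺ᵇ v) ∧ E u v) (chosenBefore v ω) (v ∷ after)
               (cong (_∧ E v v) (≺ᵇ-false {u = v} {v} (ℕₚ.<-irrefl refl))
                ∷ All.map (λ {z} v≺z → cong (_∧ E z v) (≺ᵇ-false (ℕₚ.<-asym v≺z))) after-≻)))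

    X¹-unblocked : IsSimple E → X¹ E v ω ≡ inVS ω v ∧ unblocked v ω
    X¹-unblocked simple = begin
        any isV (Sets.M₁ E ω)
      ≡⟨ cong (any isV) M₁-split ⟩
        any isV (greedy ω (Sets.step E ω (chosenBefore v ω) v) after)
      ≡⟨ greedy-any ω isV _ after (All.map (λ v≺z → ≟-≢ (λ z≡v → <⇒≢ v≺z (sym z≡v))) after-≻) ⟩
        any isV (Sets.step E ω (chosenBefore v ω) v)
      ≡⟨ v-added ⟩
        inVS ω v ∧ independent (v ∷ chosenBefore v ω)
      ≡⟨ cong (inVS ω v ∧_) (independent-cons simple v (chosenBefore v ω)
                               (greedy-independent ω [] before refl)
                               (greedy-All ω (_≺ v) [] before [] before-≺)) ⟩
        inVS ω v ∧ unblocked v ω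
      ∎
      where
      open ≡-Reasoning
      isV : Fin n → Bool
      isV u = ⌊ u ≟ v ⌋
      v-added : any isV (Sets.step E ω (chosenBefore v ω) v) ≡ inVS ω v ∧ independent (v ∷ chosenBefore v ω)
      v-added with inVS ω v ∧ independent (v ∷ chosenBefore v ω)
      ... | true  = cong (_∨ any isV (chosenBefore v ω)) (≟-refl v)
      ... | false = greedy-any ω isV [] before (All.map (λ u≺v → ≟-≢ (<⇒≢ u≺v)) before-≺)

  unblocked-local : ∀ v ω ω' → (∀ w → w ≺ v → ω w ≡ ω' w) → unblocked v ω ≡ unblocked v ω'
  unblocked-local v ω ω' agree = cong (λ xs → not (blocks xs v))
    (greedy-local ω ω' [] before (All.map (λ {w} w≺v → cong inVS₁ (agree w w≺v)) before-≺))
    where open Split (split v)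

  unblocked-ignores : ∀ v → IgnoresNode v (unblocked v)
  unblocked-ignores v ω ω' agree = unblocked-local v ω ω' (λ w w≺v → agree w (<⇒≢ w≺v))

  -- u ∈ M₃ is an event about the nodes up to u, so it ignores every later v
  M₃-ignores : ∀ {u v} → u ≺ v → IgnoresNode v (M₃ E u)
  M₃-ignores {u} {v} u≺v ω ω' agree = begin
      M₃ E u ω
    ≡⟨ cong (_∧ coin ω u) (X²-unblocked u ω) ⟩
      (inVI ω u ∧ unblocked u ω) ∧ coin ω u
    ≡⟨ cong₂ (λ o b → (inVI₁ o ∧ b) ∧ proj₂ (proj₂ o)) (agree u (<⇒≢ u≺v))
             (unblocked-local u ω ω' (λ w w≺u → agree w (<⇒≢ (ℕₚ.<-trans w≺u u≺v)))) ⟩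
      (inVI ω' u ∧ unblocked u ω') ∧ coin ω' u
    ≡⟨ cong (_∧ coin ω' u) (X²-unblocked u ω') ⟨
      M₃ E u ω'
    ∎
    where open ≡-Reasoning

record Between (k K a b : ℚ) : Set where
  constructor between
  field
    lower : k * a ≤ b
    upper : b ≤ K * a

Between⇒× : ∀ {k K a b} → Between k K a b → k * a ≤ b × b ≤ K * a
Between⇒× (between lower upper) = lower , upper

Between-* : ∀ {k K a b} e → 0ℚ ≤ e → Between k K a b → Between k K (a * e) (b * e)
Between-* {k} {K} {a} {b} e e≥0 (between lower upper) = between
  (subst (_≤ b * e) (ℚₚ.*-assoc k a e) (ℚₚ.*-monoʳ-≤-nonNeg e {{nonNegative e≥0}} lower))
  (subst (b * e ≤_) (ℚₚ.*-assoc K a e) (ℚₚ.*-monoʳ-≤-nonNeg e {{nonNegative e≥0}} upper))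

Between-÷ : ∀ {k K a b m} (m>0 : 0ℚ < m) → Between k K a b →
  Between k K ((a ÷ m) {{>-nonZero m>0}}) ((b ÷ m) {{>-nonZero m>0}})
Between-÷ {m = m} m>0 = Between-* 1/m (ℚₚ.nonNegative⁻¹ 1/m {{ℚₚ.pos⇒nonNeg 1/m {{ℚₚ.1/pos⇒pos m {{positive m>0}}}}}})
  where
  1/m : ℚ
  1/m = (1/ m) {{>-nonZero m>0}}

UnitInterval : ℚ → Set
UnitInterval x = 0ℚ ≤ x × x ≤ 1ℚ

unit-* : ∀ {a b} → UnitInterval a → UnitInterval b → UnitInterval (a * b)
unit-* {a} {b} (a≥0 , a≤1) (b≥0 , b≤1) =
  nonneg-* a≥0 b≥0 ,
  ℚₚ.≤-trans (ℚₚ.*-monoʳ-≤-nonNeg b {{nonNegative b≥0}} a≤1) (subst (_≤ 1ℚ) (sym (ℚₚ.*-identityˡ b)) b≤1)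

unitFraction : ∀ m .{{_ : ℕ.NonZero m}} → UnitInterval (ℤ.+ 1 / m)
unitFraction (suc k) =
  ℚₚ.nonNegative⁻¹ (ℤ.+ 1 / suc k) {{ℚₚ.normalize-nonNeg 1 (suc k)}} ,
  ℚₚ.toℚᵘ-cancel-≤ (ℚᵘₚ.≤-respˡ-≃ (ℚᵘₚ.≃-sym (ℚₚ.toℚᵘ-fromℚᵘ (ℚᵘ.mkℚᵘ (ℤ.+ 1) k))) (ℚᵘ.*≤* (ℤ.+≤+ (s≤s z≤n))))

inv-unit : ∀ c (hc : 1ℚ ≤ c) → UnitInterval (inv c hc)
inv-unit c hc =
  ℚₚ.nonNegative⁻¹ (inv c hc) {{ℚₚ.pos⇒nonNeg (inv c hc) {{ℚₚ.1/pos⇒pos c}}}} ,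
  ℚₚ.*-cancelˡ-≤-pos c (subst₂ _≤_ (sym (ℚₚ.*-inverseʳ c {{ℚₚ.pos⇒nonZero c}})) (sym (ℚₚ.*-identityʳ c)) hc)
  where
  instance
    c-pos : Positive c
    c-pos = positive (ℚₚ.<-≤-trans (*<* (ℤ.+<+ (s≤s z≤n))) hc)

qVal-unit : ∀ ρ (hρ : 1 ℕ.≤ ρ) c (hc : 1ℚ ≤ c) → UnitInterval (qVal ρ hρ c hc)
qVal-unit (suc r) (s≤s z≤n) c hc = unit-* (unitFraction (2 ℕ.* suc r)) (inv-unit c hc)

≤1⇒0≤1- : ∀ {x} → x ≤ 1ℚ → 0ℚ ≤ 1ℚ - x
≤1⇒0≤1- {x} x≤1 = subst (_≤ 1ℚ - x) (ℚₚ.+-inverseʳ x) (ℚₚ.+-monoˡ-≤ (- x) x≤1)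

-- For an event A ignoring node v, both joint
-- probabilities Pr[v ∈ M₁ ∧ A] and Pr[v ∈ M₂ ∧ A] are a marginal of v times
-- the common factor Pr[unblocked v ∧ A]; so ratio bounds between the V^S-
-- and V^I-marginals of v carry over to them.
transfer : ∀ {n} (E : Graph n) → IsSimple E → (W : Weights n) → (∀ v o → 0ℚ ≤ W v o) →
  (∀ v → marginal W v (λ _ → true) ≡ 1ℚ) →
  ∀ {k K} v (A : Outcome n → Bool) → IgnoresNode v A →
  Between k K (marginal W v inVS₁) (marginal W v inVI₁) →
  Between k K (Pr W (λ ω → X¹ E v ω ∧ A ω)) (Pr W (λ ω → X² E v ω ∧ A ω))
transfer E simple W nonneg normalised {k} {K} v A ignores bounds =
  subst₂ (Between k K) (sym Pr-X¹) (sym Pr-X²) (Between-* (Pr W rest) (Pr-nonneg W nonneg rest) bounds)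
  where
  open Greedy E
  rest : Outcome _ → Bool
  rest ω = unblocked v ω ∧ A ω
  rest-ignores : IgnoresNode v rest
  rest-ignores ω ω' agree = cong₂ _∧_ (unblocked-ignores v ω ω' agree) (ignores ω ω' agree)
  Pr-X¹ : Pr W (λ ω → X¹ E v ω ∧ A ω) ≡ marginal W v inVS₁ * Pr W rest
  Pr-X¹ = trans (Pr-cong W (λ ω → trans (cong (_∧ A ω) (X¹-unblocked v ω simple)) (∧-assoc (inVS ω v) _ (A ω))))
                (Pr-factor W normalised v inVS₁ rest rest-ignores)
  Pr-X² : Pr W (λ ω → X² E v ω ∧ A ω) ≡ marginal W v inVI₁ * Pr W rest
  Pr-X² = trans (Pr-cong W (λ ω → trans (cong (_∧ A ω) (X²-unblocked v ω)) (∧-assoc (inVI ω v) _ (A ω))))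
                (Pr-factor W normalised v inVI₁ rest rest-ignores)

-- The theorem: apply the transfer lemma to the paper's measure, with A
-- trivial (unconditional bounds) and with A = "u ∈ M₃" followed by division
-- by Pr[u ∈ M₃] (conditional bounds).
lemma4 : (n : ℕ) (E : Graph n) → IsSimple E →
           (ρ : ℕ) (hρ : 1 ℕ.≤ ρ) → InductiveIndependence E ρ →
           (c : ℚ) (hc : 1ℚ ≤ c) →
           (p : JointLaw n) → IsJointLaw p →
           (∀ v → inv c hc * PrVS p v ≤ PrVI p v × PrVI p v ≤ c * PrVS p v) →
           let q = qVal ρ hρ c hc in
           (∀ v → inv c hc * E[ X¹ E v ] p q ≤ E[ X² E v ] p q
                × E[ X² E v ] p q ≤ c * E[ X¹ E v ] p q)
           × (∀ u v → u ≺ v → (pos : 0ℚ < E[ M₃ E u ] p q) →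
                inv c hc * E[ X¹ E v ∣ M₃ E u ] p q pos ≤ E[ X² E v ∣ M₃ E u ] p q pos
                × E[ X² E v ∣ M₃ E u ] p q pos ≤ c * E[ X¹ E v ∣ M₃ E u ] p q pos)
lemma4 n E simple ρ hρ _ c hc p law marginalBounds =
  (λ v → Between⇒× (unconditional v)) , (λ u v u≺v pos → Between⇒× (conditional u v u≺v pos))
  where
  q : ℚ
  q = qVal ρ hρ c hc
  W : Weights n
  W = paperWeights p q
  joint : ∀ v (A : Outcome n → Bool) → IgnoresNode v A →
    Between (inv c hc) c (E[ (λ ω → X¹ E v ω ∧ A ω) ] p q) (E[ (λ ω → X² E v ω ∧ A ω) ] p q)
  joint v A ignores =
    transfer E simple W W-nonneg (paperWeights-normalised p q law) v A ignores
      (subst₂ (Between (inv c hc) c) (sym (marginal-VS p q v)) (sym (marginal-VI p q v))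
        (between (proj₁ (marginalBounds v)) (proj₂ (marginalBounds v))))
    where
    W-nonneg : ∀ v o → 0ℚ ≤ W v o
    W-nonneg = paperWeights-nonneg p q law (proj₁ (qVal-unit ρ hρ c hc)) (≤1⇒0≤1- (proj₂ (qVal-unit ρ hρ c hc)))
  unconditional : ∀ v → Between (inv c hc) c (E[ X¹ E v ] p q) (E[ X² E v ] p q)
  unconditional v = subst₂ (Between (inv c hc) c) (Pr-cong W (λ ω → ∧-identityʳ (X¹ E v ω)))
    (Pr-cong W (λ ω → ∧-identityʳ (X² E v ω))) (joint v (λ _ → true) (λ _ _ _ → refl))
  conditional : ∀ u v → u ≺ v → (pos : 0ℚ < E[ M₃ E u ] p q) →
    Between (inv c hc) c (E[ X¹ E v ∣ M₃ E u ] p q pos) (E[ X² E v ∣ M₃ E u ] p q pos)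
  conditional u v u≺v pos = Between-÷ pos (joint v (M₃ E u) (Greedy.M₃-ignores E u≺v))
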